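{- Let $A=(a,\,(u+1)a+d,\,(3u+1)a+3d,\,(10u+1)a+10d)$, where $d$ is a positive integer with $\gcd(a,d)=1$, $u\ge 2$ is an integer, and $a\ge 2$. Let $p$ be a positive divisor of $a$ with $p\ne a$. Then $$F\left(\frac{\langle A\rangle}{p}\right)=\frac{a}{p}\left(\left\lfloor\frac{a-p}{10}\right\rfloor+ua+d+\varphi_1\big((a-p)\bmod 10\big)\right)-(ua+d),$$ where $(\varphi_1(i))_{0\le i\le 9}=(-1,0,1,0,1,2,1,2,3,2)$.
   Context: $\langle A\rangle$ is the set of non-negative integer linear combinations of the entries of $A$, and $\frac{\langle A\rangle}{p}=\{x\in\mathbb{N}\mid px\in\langle A\rangle\}$ (with $\mathbb{N}$ the non-negative integers), a numerical semigroup. $F(S)$ is the largest integer not in the numerical semigroup $S$. $(a-p)\bmod 10$ denotes the remainder in $\{0,\dots,9\}$. -}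

module Defs where

open import Data.Nat using (ℕ; zero; suc; _+_; _*_)
open import Data.Integer using (ℤ; +_; -[1+_]; _<_)
open import Data.Fin using (Fin)
open import Data.Fin.Patterns using (0F; 1F; 2F; 3F)
open import Data.Product using (Σ; ∃; _×_)
open import Relation.Binary.PropositionalEquality using (_≡_)
open import Relation.Nullary using (¬_)

gens : ℕ → ℕ → ℕ → Fin 4 → ℕ
gens a u d 0F = a
gens a u d 1F = (u + 1) * a + d
gens a u d 2F = (3 * u + 1) * a + 3 * d
gens a u d 3F = (10 * u + 1) * a + 10 * d

InMonoid : (Fin 4 → ℕ) → ℕ → Set
InMonoid A x = Σ (Fin 4 → ℕ) λ c →
  c 0F * A 0F + c 1F * A 1F + c 2F * A 2F + c 3F * A 3F ≡ x

InQuotient : (Fin 4 → ℕ) → ℕ → ℕ → Set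
InQuotient A p x = InMonoid A (p * x)

Memℤ : (ℕ → Set) → ℤ → Set
Memℤ S z = ∃ λ n → z ≡ + n × S n

IsFrobeniusNumber : (ℕ → Set) → ℤ → Set
IsFrobeniusNumber S f = ¬ Memℤ S f × (∀ (z : ℤ) → f < z → Memℤ S z)

-- (φ₁(i))_{0≤i≤9} = (-1,0,1,0,1,2,1,2,3,2); value at i ≥ 10 is irrelevant (only used on i mod 10)
φ₁ : ℕ → ℤ
φ₁ 0 = -[1+ 0 ]
φ₁ 1 = + 0
φ₁ 2 = + 1
φ₁ 3 = + 0
φ₁ 4 = + 1
φ₁ 5 = + 2
φ₁ 6 = + 1
φ₁ 7 = + 2
φ₁ 8 = + 3
φ₁ 9 = + 2
φ₁ _ = + 0

-- With b = u a + d the generators are a + w b for w ∈ {0, 1, 3, 10}, so ⟨A⟩ consists of the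
-- k a + m b with k ≥ ω m, the least number of parts from {1, 3, 10} summing to m.
-- Let a = (q + 1) p with q ≥ 1, m₀ = q p = a − p and f = q b + (q + 1) ω m₀ − (q + 1).
-- If p f = k a + m b with ω m ≤ k, then (k + 1) a + (m + p) b = (ω m₀ + b) a, so a ∣ m + p
-- by coprimality; m + p = a would give k + 1 = ω m₀ = ω m ≤ k, and m + p ≥ 2a would give
-- b < ω m₀ ≤ a.
-- Every n > f is N (q + 1) + j b with j ≤ q, as q + 1 is coprime to b and n ≥ q b; then
-- p n = N a + (p j) b, and n > f gives (N + 1)(q + 1) > (q − j) b + (q + 1) ω m₀, which
-- with b ≥ 2a yields N ≥ 2 p (q − j) + ω m₀ ≥ ω (p j), since ω loses at most 2 per unit.
-- Finally φ₁ r = ω r − 1 for r < 10, which turns f into the stated formula.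

module Submission where

open import Defs
open import Data.Nat using (ℕ; _+_; _*_; _∸_; _≤_; _/_; _%_; NonZero)
open import Data.Nat.GCD using (gcd)
open import Data.Nat.Divisibility using (_∣_)
open import Data.Integer using (ℤ; +_) renaming (_+_ to _+ℤ_; _*_ to _*ℤ_; _-_ to _-ℤ_)
open import Relation.Binary.PropositionalEquality using (_≡_; _≢_)

open import Data.Empty using (⊥)
open import Data.Fin using (Fin)
open import Data.Fin.Patterns using (0F; 1F; 2F; 3F)
open import Data.Integer using (-[1+_]; +<+) renaming (_≟_ to _≟ℤ_)
open import Data.Integer.Properties using (pos-+; pos-*; m-n≡m⊖n; ⊖-≥)
import Data.Integer.Tactic.RingSolver as ℤ-Solver
open import Data.Nat
  using (zero; suc; _<_; z≤n; s≤s; s≤s⁻¹; z<s; _≤?_; _<?_; >-nonZero; >-nonZero⁻¹; ≢-nonZero⁻¹)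
open import Data.Nat.Coprimality using (Coprime; gcd≡1⇒coprime; coprime-divisor; coprime-Bézout)
open import Data.Nat.DivMod
open import Data.Nat.Divisibility using (divides; ∣m+n∣m⇒∣n; n∣m*n; m∣m*n; ∣-trans)
open import Data.Nat.GCD using (module Bézout)
open import Data.Nat.Properties
open import Data.Nat.Tactic.RingSolver using (solve-∀)
open import Data.Product using (_,_; _×_; ∃; ∃₂; map₂)
open import Function using (_∘_)
open import Relation.Binary.PropositionalEquality
  using (refl; sym; trans; cong; cong₂; subst; module ≡-Reasoning)
open import Relation.Nullary using (¬_; contradiction)
open import Relation.Nullary.Decidable using (from-yes; _→-dec_)

ω : ℕ → ℕ
ω 0 = 0
ω 1 = 1
ω 2 = 2
ω 3 = 1
ω 4 = 2
ω 5 = 3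
ω 6 = 2
ω 7 = 3
ω 8 = 4
ω 9 = 3
ω (suc (suc (suc (suc (suc (suc (suc (suc (suc (suc m)))))))))) = suc (ω m)

digit-induction : ∀ {ℓ} (P : ℕ → Set ℓ) → (∀ {r} → r < 10 → P r) →
                  (∀ m → P m → P (10 + m)) → ∀ m → P m
digit-induction P base step m = subst P (sym m≡[m/10]*10+m%10) (tens (m / 10))
  where
  m≡[m/10]*10+m%10 : m ≡ m / 10 * 10 + m % 10
  m≡[m/10]*10+m%10 = trans (m≡m%n+[m/n]*n m 10) (+-comm (m % 10) _)

  tens : ∀ q → P (q * 10 + m % 10)
  tens zero    = base (m%n<n m 10)
  tens (suc q) = step _ (tens q)

ω[1+m]≤1+ω[m] : ∀ m → ω (1 + m) ≤ 1 + ω m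
ω[1+m]≤1+ω[m] = digit-induction _
  (from-yes (allUpTo? (λ r → ω (1 + r) ≤? 1 + ω r) 10)) (λ _ → s≤s)

ω[3+m]≤1+ω[m] : ∀ m → ω (3 + m) ≤ 1 + ω m
ω[3+m]≤1+ω[m] = digit-induction _
  (from-yes (allUpTo? (λ r → ω (3 + r) ≤? 1 + ω r) 10)) (λ _ → s≤s)

ω[m]≤2+ω[1+m] : ∀ m → ω m ≤ 2 + ω (1 + m)
ω[m]≤2+ω[1+m] = digit-induction _
  (from-yes (allUpTo? (λ r → ω r ≤? 2 + ω (1 + r)) 10)) (λ _ → s≤s)

ω[m]≤m : ∀ m → ω m ≤ m
ω[m]≤m = digit-induction _
  (from-yes (allUpTo? (λ r → ω r ≤? r) 10)) (λ m ih → s≤s (≤-trans ih (m≤n+m m 9)))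

ω-positive : ∀ {m} → 0 < m → 0 < ω m
ω-positive {m} = digit-induction (λ m → 0 < m → 0 < ω m)
  (from-yes (allUpTo? (λ r → 0 <? r →-dec 0 <? ω r) 10)) (λ _ _ _ → z<s) m

ω[c*k+m]≤c+ω[m] : ∀ {k} → (∀ m → ω (k + m) ≤ 1 + ω m) → ∀ c m → ω (c * k + m) ≤ c + ω m
ω[c*k+m]≤c+ω[m]         ω-step zero    m = ≤-refl
ω[c*k+m]≤c+ω[m] {k} ω-step (suc c) m = begin
  ω (k + c * k + m)   ≡⟨ cong ω (+-assoc k (c * k) m) ⟩
  ω (k + (c * k + m)) ≤⟨ ω-step (c * k + m) ⟩
  1 + ω (c * k + m)   ≤⟨ s≤s (ω[c*k+m]≤c+ω[m] ω-step c m) ⟩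
  suc c + ω m         ∎
  where open ≤-Reasoning

ω-minimal : ∀ c₁ c₃ c₁₀ → ω (c₁ + 3 * c₃ + 10 * c₁₀) ≤ c₁ + c₃ + c₁₀
ω-minimal c₁ c₃ c₁₀ = begin
  ω (c₁ + 3 * c₃ + 10 * c₁₀)             ≡⟨ cong ω (regroup c₁ c₃ c₁₀) ⟩
  ω (c₁ * 1 + (c₃ * 3 + (c₁₀ * 10 + 0))) ≤⟨ ω[c*k+m]≤c+ω[m] ω[1+m]≤1+ω[m] c₁ _ ⟩
  c₁ + ω (c₃ * 3 + (c₁₀ * 10 + 0))
    ≤⟨ +-monoʳ-≤ c₁ (ω[c*k+m]≤c+ω[m] ω[3+m]≤1+ω[m] c₃ _) ⟩
  c₁ + (c₃ + ω (c₁₀ * 10 + 0))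
    ≤⟨ +-monoʳ-≤ c₁ (+-monoʳ-≤ c₃ (ω[c*k+m]≤c+ω[m] (λ _ → ≤-refl) c₁₀ 0)) ⟩
  c₁ + (c₃ + (c₁₀ + 0))                  ≡⟨ regroup′ c₁ c₃ c₁₀ ⟩
  c₁ + c₃ + c₁₀                          ∎
  where
  open ≤-Reasoning
  regroup : ∀ x y z → x + 3 * y + 10 * z ≡ x * 1 + (y * 3 + (z * 10 + 0))
  regroup = solve-∀
  regroup′ : ∀ x y z → x + (y + (z + 0)) ≡ x + y + z
  regroup′ = solve-∀

ω[m]≤2*t+ω[t+m] : ∀ t m → ω m ≤ 2 * t + ω (t + m)
ω[m]≤2*t+ω[t+m] zero    m = ≤-refl
ω[m]≤2*t+ω[t+m] (suc t) m = begin
  ω m                         ≤⟨ ω[m]≤2*t+ω[t+m] t m ⟩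
  2 * t + ω (t + m)           ≤⟨ +-monoʳ-≤ (2 * t) (ω[m]≤2+ω[1+m] (t + m)) ⟩
  2 * t + (2 + ω (suc t + m)) ≡⟨ regroup t (ω (suc t + m)) ⟩
  2 * suc t + ω (suc t + m)   ∎
  where
  open ≤-Reasoning
  regroup : ∀ t x → 2 * t + (2 + x) ≡ 2 * suc t + x
  regroup = solve-∀

ω-digits : ∀ m → ω m ≡ m / 10 + ω (m % 10)
ω-digits = digit-induction _
  (from-yes (allUpTo? (λ r → ω r ≟ r / 10 + ω (r % 10)) 10)) step
  where
  step : ∀ m → ω m ≡ m / 10 + ω (m % 10) → ω (10 + m) ≡ (10 + m) / 10 + ω ((10 + m) % 10)
  step m ih = begin
    suc (ω m)                          ≡⟨ cong suc ih ⟩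
    suc (m / 10) + ω (m % 10)          ≡⟨ cong₂ (λ x y → x + ω y) [10+m]/10 [10+m]%10 ⟨
    (10 + m) / 10 + ω ((10 + m) % 10)  ∎
    where
    open ≡-Reasoning
    [10+m]/10 : (10 + m) / 10 ≡ suc (m / 10)
    [10+m]/10 = m/n≡1+[m∸n]/n (m≤m+n 10 m)
    [10+m]%10 : (10 + m) % 10 ≡ m % 10
    [10+m]%10 = trans (cong (_% 10) (+-comm 10 m)) ([m+n]%n≡m%n m 10)

ω-attained : ∀ m → ∃₂ λ c₁ c₃ → ∃ λ c₁₀ →
             c₁ + 3 * c₃ + 10 * c₁₀ ≡ m × c₁ + c₃ + c₁₀ ≡ ω m
ω-attained m = r % 3 , r / 3 , m / 10 , value , count
  where
  r = m % 10

  value : r % 3 + 3 * (r / 3) + 10 * (m / 10) ≡ m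
  value = begin
    r % 3 + 3 * (r / 3) + 10 * (m / 10)
      ≡⟨ cong₂ (λ x y → r % 3 + x + y) (*-comm 3 (r / 3)) (*-comm 10 (m / 10)) ⟩
    r % 3 + r / 3 * 3 + m / 10 * 10     ≡⟨ cong (_+ m / 10 * 10) (m≡m%n+[m/n]*n r 3) ⟨
    r + m / 10 * 10                     ≡⟨ m≡m%n+[m/n]*n m 10 ⟨
    m                                   ∎
    where open ≡-Reasoning

  count : r % 3 + r / 3 + m / 10 ≡ ω m
  count = begin
    r % 3 + r / 3 + m / 10 ≡⟨ cong (_+ m / 10) (ω-below-10 (m%n<n m 10)) ⟨
    ω r + m / 10           ≡⟨ +-comm (ω r) (m / 10) ⟩
    m / 10 + ω r           ≡⟨ ω-digits m ⟨
    ω m                    ∎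
    where
    open ≡-Reasoning
    ω-below-10 : ∀ {r} → r < 10 → ω r ≡ r % 3 + r / 3
    ω-below-10 = from-yes (allUpTo? (λ r → ω r ≟ r % 3 + r / 3) 10)

ω≡[m/10]+φ₁[m%10]+1 : ∀ m → + ω m ≡ + (m / 10) +ℤ (φ₁ (m % 10) +ℤ + 1)
ω≡[m/10]+φ₁[m%10]+1 m = begin
  + ω m                               ≡⟨ cong +_ (ω-digits m) ⟩
  + (m / 10 + ω (m % 10))             ≡⟨ pos-+ (m / 10) (ω (m % 10)) ⟩
  + (m / 10) +ℤ + ω (m % 10)          ≡⟨ cong (+ (m / 10) +ℤ_) (φ₁+1≡ω (m%n<n m 10)) ⟨
  + (m / 10) +ℤ (φ₁ (m % 10) +ℤ + 1)  ∎
  where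
  open ≡-Reasoning
  φ₁+1≡ω : ∀ {r} → r < 10 → φ₁ r +ℤ + 1 ≡ + ω r
  φ₁+1≡ω = from-yes (allUpTo? (λ r → φ₁ r +ℤ + 1 ≟ℤ + ω r) 10)

Representable : ℕ → ℕ → ℕ → Set
Representable a b x = ∃₂ λ k m → ω m ≤ k × k * a + m * b ≡ x

combination-of-gens : ∀ a u d c₀ c₁ c₃ c₁₀ →
  c₀ * a + c₁ * ((u + 1) * a + d) + c₃ * ((3 * u + 1) * a + 3 * d) + c₁₀ * ((10 * u + 1) * a + 10 * d)
    ≡ (c₀ + (c₁ + c₃ + c₁₀)) * a + (c₁ + 3 * c₃ + 10 * c₁₀) * (u * a + d)
combination-of-gens = solve-∀

InMonoid⇒Representable : ∀ {a u d x} → InMonoid (gens a u d) x → Representable a (u * a + d) x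
InMonoid⇒Representable {a} {u} {d} (c , c·gens≡x) =
  c 0F + (c 1F + c 2F + c 3F) , c 1F + 3 * c 2F + 10 * c 3F ,
  ≤-trans (ω-minimal (c 1F) (c 2F) (c 3F)) (m≤n+m _ (c 0F)) ,
  trans (sym (combination-of-gens a u d (c 0F) (c 1F) (c 2F) (c 3F))) c·gens≡x

Representable⇒InMonoid : ∀ {a u d x} → Representable a (u * a + d) x → InMonoid (gens a u d) x
Representable⇒InMonoid {a} {u} {d} {x} (k , m , ωm≤k , ka+mb≡x) with ω-attained m
... | c₁ , c₃ , c₁₀ , value , count = c , (begin
  (k ∸ ω m) * a + c₁ * gens a u d 1F + c₃ * gens a u d 2F + c₁₀ * gens a u d 3F
    ≡⟨ combination-of-gens a u d (k ∸ ω m) c₁ c₃ c₁₀ ⟩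
  (k ∸ ω m + (c₁ + c₃ + c₁₀)) * a + (c₁ + 3 * c₃ + 10 * c₁₀) * (u * a + d)
    ≡⟨ cong₂ (λ k′ m′ → k′ * a + m′ * (u * a + d))
             (trans (cong (λ z → k ∸ ω m + z) count) (m∸n+n≡m ωm≤k)) value ⟩
  k * a + m * (u * a + d)
    ≡⟨ ka+mb≡x ⟩
  x ∎)
  where
  open ≡-Reasoning
  c : Fin 4 → ℕ
  c 0F = k ∸ ω m
  c 1F = c₁
  c 2F = c₃
  c 3F = c₁₀

modular-inverse : ∀ {q b} → Coprime (suc q) b → ∃ λ y → (y * b) % suc q ≡ 1 % suc q
modular-inverse {q} {b} coprime with coprime-Bézout coprime
... | Bézout.-+ x y 1+xQ≡yb = y , (begin
  (y * b) % suc q           ≡⟨ cong (_% suc q) 1+xQ≡yb ⟨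
  (1 + x * suc q) % suc q   ≡⟨ [m+kn]%n≡m%n 1 x (suc q) ⟩
  1 % suc q                 ∎)
  where open ≡-Reasoning
... | Bézout.+- x y 1+yb≡xQ = q * y , (begin
  (q * y * b) % suc q           ≡⟨ [m+n]%n≡m%n (q * y * b) (suc q) ⟨
  (q * y * b + suc q) % suc q   ≡⟨ cong (_% suc q) qyb+Q≡1+qxQ ⟩
  (1 + q * x * suc q) % suc q   ≡⟨ [m+kn]%n≡m%n 1 (q * x) (suc q) ⟩
  1 % suc q                     ∎)
  where
  open ≡-Reasoning
  -- y b ≡ -1, so q y b ≡ -q ≡ 1 (mod q + 1)
  qyb+Q≡1+qxQ : q * y * b + suc q ≡ 1 + q * x * suc q
  qyb+Q≡1+qxQ = begin
    q * y * b + suc q     ≡⟨ regroup q y b ⟩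
    1 + q * (1 + y * b)   ≡⟨ cong (λ z → 1 + q * z) 1+yb≡xQ ⟩
    1 + q * (x * suc q)   ≡⟨ cong suc (*-assoc q x (suc q)) ⟨
    1 + q * x * suc q     ∎
    where
    regroup : ∀ q y b → q * y * b + suc q ≡ 1 + q * (1 + y * b)
    regroup = solve-∀

*-congˡ-mod : ∀ m m′ n d .{{_ : NonZero d}} → m % d ≡ m′ % d → (m * n) % d ≡ (m′ * n) % d
*-congˡ-mod m m′ n d m≡m′ = begin
  (m * n) % d                  ≡⟨ %-distribˡ-* m n d ⟩
  ((m % d) * (n % d)) % d      ≡⟨ cong (λ z → (z * (n % d)) % d) m≡m′ ⟩
  ((m′ % d) * (n % d)) % d     ≡⟨ %-distribˡ-* m′ n d ⟨
  (m′ * n) % d                 ∎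
  where open ≡-Reasoning

multiple-≡-mod : ∀ {q b} → Coprime (suc q) b → ∀ n → ∃ λ j → j < suc q × (j * b) % suc q ≡ n % suc q
multiple-≡-mod {q} {b} coprime n with modular-inverse coprime
... | y , yb≡1 = (n * y) % suc q , m%n<n (n * y) (suc q) , (begin
  ((n * y) % suc q * b) % suc q  ≡⟨ *-congˡ-mod ((n * y) % suc q) (n * y) b (suc q) (m%n%n≡m%n (n * y) (suc q)) ⟩
  (n * y * b) % suc q            ≡⟨ cong (_% suc q) (*-assoc n y b) ⟩
  (n * (y * b)) % suc q          ≡⟨ cong (_% suc q) (*-comm n (y * b)) ⟩
  (y * b * n) % suc q            ≡⟨ *-congˡ-mod (y * b) 1 n (suc q) yb≡1 ⟩
  (1 * n) % suc q                ≡⟨ cong (_% suc q) (*-identityˡ n) ⟩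
  n % suc q                      ∎)
  where open ≡-Reasoning

≡-mod⇒+-multiple : ∀ {m n} d .{{_ : NonZero d}} → m % d ≡ n % d → m ≤ n → ∃ λ N → N * d + m ≡ n
≡-mod⇒+-multiple {m} {n} d m≡n m≤n = N , (begin
  N * d + m                      ≡⟨ cong (λ z → N * d + z) (m≡m%n+[m/n]*n m d) ⟩
  N * d + (m % d + m / d * d)    ≡⟨ regroup (N * d) (m % d) (m / d * d) ⟩
  m % d + (N * d + m / d * d)    ≡⟨ cong₂ _+_ m≡n (sym (*-distribʳ-+ d N (m / d))) ⟩
  n % d + (N + m / d) * d        ≡⟨ cong (λ z → n % d + z * d) (m∸n+n≡m (/-monoˡ-≤ d m≤n)) ⟩
  n % d + n / d * d              ≡⟨ m≡m%n+[m/n]*n n d ⟨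
  n                              ∎)
  where
  open ≡-Reasoning
  N = n / d ∸ m / d
  regroup : ∀ x y z → x + (y + z) ≡ y + (x + z)
  regroup = solve-∀

coprime⇒representation : ∀ {q b n} → Coprime (suc q) b → q * b ≤ n →
                         ∃₂ λ N j → j < suc q × N * suc q + j * b ≡ n
coprime⇒representation {q} {b} {n} coprime qb≤n with multiple-≡-mod coprime n
... | j , j<Q , jb≡n with ≡-mod⇒+-multiple (suc q) jb≡n (≤-trans (*-monoˡ-≤ b (s≤s⁻¹ j<Q)) qb≤n)
...   | N , NQ+jb≡n = N , j , j<Q , NQ+jb≡n

coprime-*+ : ∀ {a d} u → Coprime a d → Coprime a (u * a + d)
coprime-*+ u coprime (i∣a , i∣ua+d) = coprime (i∣a , ∣m+n∣m⇒∣n i∣ua+d (∣-trans i∣a (n∣m*n u)))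

∣-coefficient : ∀ {a b} x y z → Coprime a b → x * a + y * b ≡ z * a → a ∣ y
∣-coefficient {a} {b} x y z coprime xa+yb≡za =
  coprime-divisor coprime (subst (a ∣_) (*-comm y b) (∣m+n∣m⇒∣n (divides z xa+yb≡za) (n∣m*n x)))

representation-gap : ∀ {a b p m₀ x} .{{_ : NonZero p}} → Coprime a b → a < b → m₀ + p ≡ a →
                     Representable a b x → x + a ≢ ω m₀ * a + m₀ * b
representation-gap {a} {b} {p} {m₀} coprime a<b m₀+p≡a (k , m , ωm≤k , refl) ka+mb+a≡top =
  impossible t m+p≡ta cancelled
  where
  instance
    a≢0 : NonZero a
    a≢0 = >-nonZero (subst (0 <_) m₀+p≡a (<-≤-trans (>-nonZero⁻¹ p) (m≤n+m p m₀)))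

  shifted : (k + 1) * a + (m + p) * b ≡ (ω m₀ + b) * a
  shifted = begin
    (k + 1) * a + (m + p) * b        ≡⟨ regroup k a m b p ⟩
    k * a + m * b + a + p * b        ≡⟨ cong (_+ p * b) ka+mb+a≡top ⟩
    ω m₀ * a + m₀ * b + p * b        ≡⟨ regroup′ (ω m₀) a m₀ b p ⟩
    ω m₀ * a + (m₀ + p) * b          ≡⟨ cong (λ z → ω m₀ * a + z * b) m₀+p≡a ⟩
    ω m₀ * a + a * b                 ≡⟨ regroup″ (ω m₀) a b ⟩
    (ω m₀ + b) * a                   ∎
    where
    open ≡-Reasoning
    regroup : ∀ k a m b p → (k + 1) * a + (m + p) * b ≡ k * a + m * b + a + p * b
    regroup = solve-∀
    regroup′ : ∀ w a m b p → w * a + m * b + p * b ≡ w * a + (m + p) * b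
    regroup′ = solve-∀
    regroup″ : ∀ w a b → w * a + a * b ≡ (w + b) * a
    regroup″ = solve-∀

  open _∣_ (∣-coefficient (k + 1) (m + p) (ω m₀ + b) coprime shifted)
    using () renaming (quotient to t; equality to m+p≡ta)

  cancelled : k + 1 + t * b ≡ ω m₀ + b
  cancelled = *-cancelʳ-≡ _ _ a (begin
    (k + 1 + t * b) * a          ≡⟨ regroup k t a b ⟩
    (k + 1) * a + t * a * b      ≡⟨ cong (λ z → (k + 1) * a + z * b) m+p≡ta ⟨
    (k + 1) * a + (m + p) * b    ≡⟨ shifted ⟩
    (ω m₀ + b) * a               ∎)
    where
    open ≡-Reasoning
    regroup : ∀ k t a b → (k + 1 + t * b) * a ≡ (k + 1) * a + t * a * b
    regroup = solve-∀

  impossible : ∀ t → m + p ≡ t * a → k + 1 + t * b ≡ ω m₀ + b → ⊥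
  impossible zero m+p≡0 _ = ≢-nonZero⁻¹ p (m+n≡0⇒n≡0 m m+p≡0)
  impossible 1 m+p≡a k+1+b≡ωm₀+b = n≮n k (begin-strict
    k        <⟨ n<1+n k ⟩
    suc k    ≡⟨ +-comm 1 k ⟩
    k + 1    ≡⟨ k+1≡ωm₀ ⟩
    ω m₀     ≡⟨ cong ω m₀≡m ⟩
    ω m      ≤⟨ ωm≤k ⟩
    k        ∎)
    where
    open ≤-Reasoning
    k+1≡ωm₀ : k + 1 ≡ ω m₀
    k+1≡ωm₀ = +-cancelʳ-≡ b _ _ (trans (cong (λ z → k + 1 + z) (sym (*-identityˡ b))) k+1+b≡ωm₀+b)
    m₀≡m : m₀ ≡ m
    m₀≡m = +-cancelʳ-≡ p m₀ m (trans m₀+p≡a (trans (sym (*-identityˡ a)) (sym m+p≡a)))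
  impossible (suc (suc t)) _ k+1+[2+t]b≡ωm₀+b = n≮n b (begin-strict
    b        <⟨ +-cancelʳ-≤ b (suc b) (ω m₀) (begin
                  suc b + b                  ≤⟨ m≤m+n (suc b + b) (k + t * b) ⟩
                  suc b + b + (k + t * b)    ≡⟨ regroup k t b ⟩
                  k + 1 + (2 + t) * b        ≡⟨ k+1+[2+t]b≡ωm₀+b ⟩
                  ω m₀ + b                   ∎) ⟩
    ω m₀     ≤⟨ ω[m]≤m m₀ ⟩
    m₀       ≤⟨ subst (m₀ ≤_) m₀+p≡a (m≤m+n m₀ p) ⟩
    a        <⟨ a<b ⟩
    b        ∎)
    where
    open ≤-Reasoning
    regroup : ∀ k t b → suc b + b + (k + t * b) ≡ k + 1 + (2 + t) * b
    regroup = solve-∀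

Memℤ-map : ∀ {S T : ℕ → Set} → (∀ {n} → S n → T n) → ∀ {z} → Memℤ S z → Memℤ T z
Memℤ-map S⇒T = map₂ (map₂ S⇒T)

IsFrobeniusNumber-resp : ∀ {S T : ℕ → Set} {f} → (∀ {n} → S n → T n) → (∀ {n} → T n → S n) →
                         IsFrobeniusNumber S f → IsFrobeniusNumber T f
IsFrobeniusNumber-resp S⇒T T⇒S (f∉S , S-above) =
  f∉S ∘ Memℤ-map T⇒S , λ z f<z → Memℤ-map S⇒T (S-above z f<z)

isFrobeniusNumber : ∀ {S : ℕ → Set} {f} → ¬ S f → (∀ {n} → f < n → S n) → IsFrobeniusNumber S (+ f)
isFrobeniusNumber f∉S S-above =
  (λ { (_ , refl , f∈S) → f∉S f∈S }) ,
  λ { (+ n) (+<+ f<n) → n , refl , S-above f<n ; -[1+ _ ] () }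

module _ {p q b : ℕ} .{{_ : NonZero p}} (1≤q : 1 ≤ q)
         (coprime : Coprime (suc q * p) b) (2a≤b : 2 * (suc q * p) ≤ b) where

  private
    -- p * top = ω (q p) a + (q p) b is the largest element of Ap(⟨A⟩, a) divisible by p.
    top : ℕ
    top = q * b + suc q * ω (q * p)

    Q≤Qω[qp] : suc q ≤ suc q * ω (q * p)
    Q≤Qω[qp] = begin
      suc q             ≡⟨ *-identityʳ (suc q) ⟨
      suc q * 1         ≤⟨ *-monoʳ-≤ (suc q) (ω-positive 0<qp) ⟩
      suc q * ω (q * p) ∎
      where
      open ≤-Reasoning
      0<qp : 0 < q * p
      0<qp = <-≤-trans (>-nonZero⁻¹ p) (m≤n*m p q {{>-nonZero 1≤q}})

    Q≤top : suc q ≤ top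
    Q≤top = ≤-trans Q≤Qω[qp] (m≤n+m _ (q * b))

    f : ℕ
    f = top ∸ suc q

    f+Q≡top : f + suc q ≡ top
    f+Q≡top = m∸n+n≡m Q≤top

    p*f-unrepresentable : ¬ Representable (suc q * p) b (p * f)
    p*f-unrepresentable rep = representation-gap coprime a<b (+-comm (q * p) p) rep (begin
      p * f + suc q * p                   ≡⟨ regroup p f q ⟩
      p * (f + suc q)                     ≡⟨ cong (p *_) f+Q≡top ⟩
      p * (q * b + suc q * ω (q * p))     ≡⟨ regroup′ p q b (ω (q * p)) ⟩
      ω (q * p) * (suc q * p) + q * p * b ∎)
      where
      open ≡-Reasoning
      a<b : suc q * p < b
      a<b = <-≤-trans (m<m*n (suc q * p) 2 {{m*n≢0 (suc q) p}} (s≤s (s≤s z≤n)))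
                      (subst (_≤ b) (*-comm 2 (suc q * p)) 2a≤b)
      regroup : ∀ p f q → p * f + suc q * p ≡ p * (f + suc q)
      regroup = solve-∀
      regroup′ : ∀ p q b w → p * (q * b + suc q * w) ≡ w * (suc q * p) + q * p * b
      regroup′ = solve-∀

    qb≤n : ∀ {n} → f < n → q * b ≤ n
    qb≤n {n} f<n = <⇒≤ (+-cancelʳ-< (suc q) (q * b) n (begin-strict
      q * b + suc q   ≤⟨ +-monoʳ-≤ (q * b) Q≤Qω[qp] ⟩
      top             ≡⟨ f+Q≡top ⟨
      f + suc q       <⟨ +-monoˡ-< (suc q) f<n ⟩
      n + suc q       ∎))
      where open ≤-Reasoning

    ω[pj]≤N : ∀ {n N j k} → f < n → N * suc q + j * b ≡ n → j + k ≡ q → ω (p * j) ≤ N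
    ω[pj]≤N {n} {N} {j} {k} f<n NQ+jb≡n j+k≡q = s≤s⁻¹ (begin-strict
      ω (p * j)                         ≤⟨ ω[m]≤2*t+ω[t+m] (p * k) (p * j) ⟩
      2 * (p * k) + ω (p * k + p * j)   ≡⟨ cong (λ z → 2 * (p * k) + ω z) pk+pj≡qp ⟩
      2 * (p * k) + ω (q * p)           <⟨ *-cancelʳ-< (suc q) _ _ bound ⟩
      suc N                             ∎)
      where
      open ≤-Reasoning
      pk+pj≡qp : p * k + p * j ≡ q * p
      pk+pj≡qp = trans (sym (*-distribˡ-+ p k j)) (trans (cong (p *_) (trans (+-comm k j) j+k≡q)) (*-comm p q))

      bound : (2 * (p * k) + ω (q * p)) * suc q < suc N * suc q
      bound = begin-strict
        (2 * (p * k) + ω (q * p)) * suc q           ≡⟨ regroup p k q (ω (q * p)) ⟩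
        k * (2 * (suc q * p)) + suc q * ω (q * p)   ≤⟨ +-monoˡ-≤ _ (*-monoʳ-≤ k 2a≤b) ⟩
        k * b + suc q * ω (q * p)                   <⟨ +-cancelʳ-< (j * b) _ _ (begin-strict
          k * b + suc q * ω (q * p) + j * b           ≡⟨ regroup′ k b (suc q * ω (q * p)) j ⟩
          (j + k) * b + suc q * ω (q * p)             ≡⟨ cong (λ z → z * b + suc q * ω (q * p)) j+k≡q ⟩
          top                                         ≡⟨ f+Q≡top ⟨
          f + suc q                                   <⟨ +-monoˡ-< (suc q) f<n ⟩
          n + suc q                                   ≡⟨ cong (_+ suc q) NQ+jb≡n ⟨
          N * suc q + j * b + suc q                   ≡⟨ regroup″ N q j b ⟩
          suc N * suc q + j * b                       ∎) ⟩
        suc N * suc q                               ∎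
        where
        regroup : ∀ p k q w → (2 * (p * k) + w) * suc q ≡ k * (2 * (suc q * p)) + suc q * w
        regroup = solve-∀
        regroup′ : ∀ k b w j → k * b + w + j * b ≡ (j + k) * b + w
        regroup′ = solve-∀
        regroup″ : ∀ N q j b → N * suc q + j * b + suc q ≡ suc N * suc q + j * b
        regroup″ = solve-∀

    representable-above-f : ∀ {n} → f < n → Representable (suc q * p) b (p * n)
    representable-above-f {n} f<n with coprime⇒representation coprime-Q (qb≤n f<n)
      where
      coprime-Q : Coprime (suc q) b
      coprime-Q (i∣Q , i∣b) = coprime (∣-trans i∣Q (m∣m*n p) , i∣b)
    ... | N , j , j<Q , NQ+jb≡n with m≤n⇒∃[o]m+o≡n (s≤s⁻¹ j<Q)
    ...   | k , j+k≡q = N , p * j , ω[pj]≤N f<n NQ+jb≡n j+k≡q , (begin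
      N * (suc q * p) + p * j * b     ≡⟨ regroup N q p j b ⟩
      p * (N * suc q + j * b)         ≡⟨ cong (p *_) NQ+jb≡n ⟩
      p * n                           ∎)
      where
      open ≡-Reasoning
      regroup : ∀ N q p j b → N * (suc q * p) + p * j * b ≡ p * (N * suc q + j * b)
      regroup = solve-∀

  quotient-frobenius : IsFrobeniusNumber (λ n → Representable (suc q * p) b (p * n))
                                         (+ (q * b + suc q * ω (q * p)) -ℤ + suc q)
  quotient-frobenius = subst (IsFrobeniusNumber _) (sym (trans (m-n≡m⊖n top (suc q)) (⊖-≥ Q≤top)))
    (isFrobeniusNumber p*f-unrepresentable representable-above-f)

frobenius-formula : ∀ p q b .{{_ : NonZero p}} →
  + (suc q * p / p) *ℤ (+ ((suc q * p ∸ p) / 10) +ℤ + b +ℤ φ₁ ((suc q * p ∸ p) % 10)) -ℤ + b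
    ≡ + (q * b + suc q * ω (q * p)) -ℤ + suc q
frobenius-formula p q b = begin
  + (suc q * p / p) *ℤ (+ ((suc q * p ∸ p) / 10) +ℤ + b +ℤ φ₁ ((suc q * p ∸ p) % 10)) -ℤ + b
    ≡⟨ cong₂ (λ Q m → + Q *ℤ (+ (m / 10) +ℤ + b +ℤ φ₁ (m % 10)) -ℤ + b)
             (m*n/n≡m (suc q) p) (m+n∸m≡n p (q * p)) ⟩
  + suc q *ℤ (+ s +ℤ + b +ℤ φ) -ℤ + b
    ≡⟨ cong (λ Q → Q *ℤ (+ s +ℤ + b +ℤ φ) -ℤ + b) (pos-+ 1 q) ⟩
  (+ 1 +ℤ + q) *ℤ (+ s +ℤ + b +ℤ φ) -ℤ + b
    ≡⟨ rearrange (+ q) (+ b) (+ s) φ ⟩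
  + q *ℤ + b +ℤ (+ 1 +ℤ + q) *ℤ (+ s +ℤ (φ +ℤ + 1)) -ℤ (+ 1 +ℤ + q)
    ≡⟨ cong₂ (λ Q w → + q *ℤ + b +ℤ Q *ℤ w -ℤ Q)
             (sym (pos-+ 1 q)) (sym (ω≡[m/10]+φ₁[m%10]+1 (q * p))) ⟩
  + q *ℤ + b +ℤ + suc q *ℤ + ω (q * p) -ℤ + suc q
    ≡⟨ cong₂ (λ x y → x +ℤ y -ℤ + suc q) (pos-* q b) (pos-* (suc q) (ω (q * p))) ⟨
  + (q * b) +ℤ + (suc q * ω (q * p)) -ℤ + suc q
    ≡⟨ cong (_-ℤ + suc q) (pos-+ (q * b) (suc q * ω (q * p))) ⟨
  + (q * b + suc q * ω (q * p)) -ℤ + suc q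
    ∎
  where
  open ≡-Reasoning
  s = q * p / 10
  φ = φ₁ (q * p % 10)
  rearrange : ∀ q b s φ → (+ 1 +ℤ q) *ℤ (s +ℤ b +ℤ φ) -ℤ b
                        ≡ q *ℤ b +ℤ (+ 1 +ℤ q) *ℤ (s +ℤ (φ +ℤ + 1)) -ℤ (+ 1 +ℤ q)
  rearrange = ℤ-Solver.solve-∀

proposition4p2 : (a u d p : ℕ) → .{{_ : NonZero d}} → .{{_ : NonZero p}} →
    gcd a d ≡ 1 → 2 ≤ u → 2 ≤ a → p ∣ a → p ≢ a →
    IsFrobeniusNumber (InQuotient (gens a u d) p)
      ((+ (a / p)) *ℤ (+ ((a ∸ p) / 10) +ℤ + (u * a + d) +ℤ φ₁ ((a ∸ p) % 10))
        -ℤ + (u * a + d))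
proposition4p2 _ u d p _ _ () (divides zero refl) _
proposition4p2 _ u d p _ _ _ (divides 1 refl) p≢a = contradiction (sym (+-identityʳ p)) p≢a
proposition4p2 _ u d p gcd≡1 2≤u _ (divides (suc q@(suc _)) refl) _ =
  subst (IsFrobeniusNumber _) (sym (frobenius-formula p q (u * a + d)))
    (IsFrobeniusNumber-resp (Representable⇒InMonoid {a} {u} {d}) (InMonoid⇒Representable {a} {u} {d})
      (quotient-frobenius (s≤s z≤n) (coprime-*+ u (gcd≡1⇒coprime gcd≡1)) 2a≤b))
  where
  a = suc q * p
  2a≤b : 2 * a ≤ u * a + d
  2a≤b = ≤-trans (*-monoˡ-≤ a 2≤u) (m≤m+n (u * a) d)
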